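{- Let $n\ge1$. The path $P_n$ admits an extended irregular dominating set if and only if $n\notin\{2,3\}$.
   Context: $P_n$ is the path on $n$ vertices $[x_1,\dots,x_n]$ with edges $\{x_i,x_{i+1}\}$, $1\le i\le n-1$. For a graph $\Gamma=(V,E)$ with distance $d$: a vertex $v$ carrying a positive integer label $\ell$ dominates exactly the vertices $u$ with $d(u,v)=\ell$; a vertex carrying label $0$ dominates only itself. An extended irregular dominating set is a set $S\subseteq V$ with an injective labeling $\lambda:S\to\{0,1,2,\dots\}$ such that every vertex of $V$ is dominated by some vertex of $S$, where some vertex of $S$ has label $0$. -}

module Defs where

open import Data.Nat using (ℕ; zero; suc; ∣_-_∣)
open import Data.Fin using (Fin; toℕ)
open import Data.Maybe using (Maybe; just; nothing)
open import Data.Product using (Σ; ∃; _×_; _,_)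
open import Relation.Binary.PropositionalEquality using (_≡_)

-- Path P_n: vertices x_1..x_n represented by Fin n (x_{i+1} ↦ i),
-- edges {x_i, x_{i+1}}.  Its graph distance is d(x_i, x_j) = |i - j|.
pathDist : {n : ℕ} → Fin n → Fin n → ℕ
pathDist i j = ∣ toℕ i - toℕ j ∣

-- A labelled subset: lab v = just ℓ means v ∈ S with λ(v) = ℓ;
-- lab v = nothing means v ∉ S.
Labelling : ℕ → Set
Labelling n = Fin n → Maybe ℕ

Dominates : {n : ℕ} → Fin n → ℕ → Fin n → Set
Dominates v zero    u = u ≡ v
Dominates v (suc ℓ) u = pathDist u v ≡ suc ℓ

InjectiveOnS : {n : ℕ} → Labelling n → Set
InjectiveOnS {n} lab = (v w : Fin n) (ℓ : ℕ) → lab v ≡ just ℓ → lab w ≡ just ℓ → v ≡ w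

DominatesAll : {n : ℕ} → Labelling n → Set
DominatesAll {n} lab = (u : Fin n) → Σ (Fin n) λ v → Σ ℕ λ ℓ → (lab v ≡ just ℓ) × Dominates v ℓ u

HasZeroLabel : {n : ℕ} → Labelling n → Set
HasZeroLabel {n} lab = Σ (Fin n) λ v → lab v ≡ just zero

IsExtendedIrregularDominating : {n : ℕ} → Labelling n → Set
IsExtendedIrregularDominating lab = InjectiveOnS lab × DominatesAll lab × HasZeroLabel lab

PathAdmitsEIDS : ℕ → Set
PathAdmitsEIDS n = Σ (Labelling n) IsExtendedIrregularDominating

-- In P₂ and P₃ every way of choosing, for each vertex u, a dominator v labelled
-- with d(u, v) forces either two labels on one vertex or one label on two
-- vertices.  For n ≥ 4 everything grows out of the labelling [3,0,2,1,-] of P₅: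
-- if the last vertex of P_{k+1} is unlabelled and all labels are at most k,
-- prepend a vertex labelled k+2, label the old last vertex k+1 and append an
-- unlabelled vertex.  This yields P_{k+3} in the same shape, and deleting the
-- unlabelled last vertex gives P_{k+2}.
module Submission where

open import Defs
open import Data.Nat using (ℕ; zero; suc; _+_; _≤_; _<_; z≤n; s≤s; ∣_-_∣; _≟_)
open import Data.Nat.Properties
  using (≤ᵇ⇒≤; ≤-refl; ≤-trans; ≤-pred; n≤1+n; n<1+n; m<n+m; m≤n+m; 1+n≢n; ≤⇒≯; ≤∧≢⇒<;
         m<n⇒m<1+n; m≤n⇒m<n∨m≡n; ∣m-n∣≡0⇒m≡n; ∣n-n∣≡0)
open import Data.Fin using (Fin; toℕ; fromℕ<)
open import Data.Fin.Patterns using (0F; 1F; 2F)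
open import Data.Fin.Properties using (toℕ-injective; toℕ<n; toℕ-fromℕ<)
open import Data.Maybe using (Maybe; just; nothing)
open import Data.Maybe.Properties using (just-injective)
open import Data.Product using (Σ; _×_; _,_; proj₂)
open import Data.Sum using (_⊎_; inj₁; inj₂) renaming (map to ⊎-map)
open import Relation.Nullary using (¬_; yes; no; contradiction)
open import Relation.Binary.PropositionalEquality
  using (_≡_; _≢_; refl; sym; trans; cong; subst)
open import Function.Bundles using (_⇔_; mk⇔)

Dominates⇒pathDist : ∀ {n} {u v : Fin n} ℓ → Dominates v ℓ u → pathDist u v ≡ ℓ
Dominates⇒pathDist {u = u} zero    refl = ∣n-n∣≡0 (toℕ u)
Dominates⇒pathDist         (suc ℓ) d    = d

pathDist⇒Dominates : ∀ {n} {u v : Fin n} ℓ → pathDist u v ≡ ℓ → Dominates v ℓ u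
pathDist⇒Dominates zero    d = toℕ-injective (∣m-n∣≡0⇒m≡n d)
pathDist⇒Dominates (suc ℓ) d = d

DominatesAll⇒dominator : ∀ {n} {lab : Labelling n} → DominatesAll lab →
                         (u : Fin n) → Σ (Fin n) λ v → lab v ≡ just (pathDist u v)
DominatesAll⇒dominator dominatesAll u with dominatesAll u
... | v , ℓ , labelled , dominates =
  v , subst (λ ℓ′ → _ ≡ just ℓ′) (sym (Dominates⇒pathDist ℓ dominates)) labelled

label-unique : ∀ {A : Set} {x : Maybe A} {a b} → x ≡ just a → x ≡ just b → a ≡ b
label-unique p q = just-injective (trans (sym p) q)

P₂-lacksEIDS : ¬ PathAdmitsEIDS 2
P₂-lacksEIDS (lab , injective , dominatesAll , _)
  with DominatesAll⇒dominator dominatesAll 0F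
     | DominatesAll⇒dominator dominatesAll 1F
... | 0F , e₀ | 0F , e₁ = contradiction (label-unique e₀ e₁) λ ()
... | 0F , e₀ | 1F , e₁ = contradiction (injective _ _ _ e₀ e₁) λ ()
... | 1F , e₀ | 0F , e₁ = contradiction (injective _ _ _ e₀ e₁) λ ()
... | 1F , e₀ | 1F , e₁ = contradiction (label-unique e₀ e₁) λ ()

P₃-lacksEIDS : ¬ PathAdmitsEIDS 3
P₃-lacksEIDS (lab , injective , dominatesAll , _)
  with DominatesAll⇒dominator dominatesAll 0F
     | DominatesAll⇒dominator dominatesAll 1F
     | DominatesAll⇒dominator dominatesAll 2F
... | 0F , e₀ | 1F , e₁ | _      = contradiction (injective _ _ _ e₀ e₁) λ ()
... | 1F , e₀ | 1F , e₁ | _      = contradiction (label-unique e₀ e₁) λ ()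
... | 2F , e₀ | 1F , _  | 2F , e₂ = contradiction (label-unique e₀ e₂) λ ()
... | 2F , _  | 1F , e₁ | 1F , e₂ = contradiction (label-unique e₁ e₂) λ ()
... | 2F , e₀ | 1F , _  | 0F , e₂ = contradiction (injective _ _ _ e₀ e₂) λ ()
... | _       | 0F , e₁ | 1F , e₂ = contradiction (injective _ _ _ e₁ e₂) λ ()
... | _       | 0F , e₁ | 0F , e₂ = contradiction (label-unique e₁ e₂) λ ()
... | 0F , e₀ | 0F , e₁ | 2F , _  = contradiction (label-unique e₀ e₁) λ ()
... | 1F , e₀ | 0F , e₁ | 2F , _  = contradiction (injective _ _ _ e₀ e₁) λ ()
... | 2F , e₀ | 0F , _  | 2F , e₂ = contradiction (label-unique e₀ e₂) λ ()
... | 1F , e₀ | 2F , e₁ | _      = contradiction (injective _ _ _ e₀ e₁) λ ()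
... | 2F , e₀ | 2F , e₁ | _      = contradiction (label-unique e₀ e₁) λ ()
... | 0F , e₀ | 2F , _  | 0F , e₂ = contradiction (label-unique e₀ e₂) λ ()
... | 0F , _  | 2F , e₁ | 1F , e₂ = contradiction (injective _ _ _ e₁ e₂) λ ()
... | 0F , _  | 2F , e₁ | 2F , e₂ = contradiction (label-unique e₁ e₂) λ ()

-- Labellings of P_n indexed by ℕ rather than Fin n, which makes shifting
-- vertices painless.
record IsEIDSOn (n : ℕ) (g : ℕ → Maybe ℕ) : Set where
  field
    supported : ∀ {v ℓ} → g v ≡ just ℓ → v < n
    injective : ∀ {v w ℓ} → g v ≡ just ℓ → g w ≡ just ℓ → v ≡ w
    dominator : ∀ {u} → u < n → Σ ℕ λ v → g v ≡ just ∣ u - v ∣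
    zeroLabel : Σ ℕ λ v → g v ≡ just 0

  unlabelled : ∀ {v} → n ≤ v → g v ≡ nothing
  unlabelled {v} n≤v with g v in e
  ... | nothing = refl
  ... | just _  = contradiction (supported e) (≤⇒≯ n≤v)

IsEIDSOn⇒PathAdmitsEIDS : ∀ {n g} → IsEIDSOn n g → PathAdmitsEIDS n
IsEIDSOn⇒PathAdmitsEIDS {n} {g} eids =
  lab ,
  (λ v w ℓ p q → toℕ-injective (injective p q)) ,
  dominatesAll ,
  _ , atFin (proj₂ zeroLabel)
  where
  open IsEIDSOn eids
  lab : Labelling n
  lab v = g (toℕ v)

  atFin : ∀ {v ℓ} (e : g v ≡ just ℓ) → lab (fromℕ< (supported e)) ≡ just ℓ
  atFin {ℓ = ℓ} e = subst (λ x → g x ≡ just ℓ) (sym (toℕ-fromℕ< (supported e))) e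

  dominatesAll : DominatesAll lab
  dominatesAll u with dominator (toℕ<n u)
  ... | v , e =
    fromℕ< (supported e) , ∣ toℕ u - v ∣ , atFin e ,
    pathDist⇒Dominates _ (cong (λ x → ∣ toℕ u - x ∣) (toℕ-fromℕ< (supported e)))

record Extendable (k : ℕ) (g : ℕ → Maybe ℕ) : Set where
  field
    eids           : IsEIDSOn (suc k) g
    lastUnlabelled : g k ≡ nothing
    labelsBelow    : ∀ {v ℓ} → g v ≡ just ℓ → ℓ ≤ k

  open IsEIDSOn eids public

  labelled⇒notLast : ∀ {v ℓ} → g v ≡ just ℓ → v ≢ k
  labelled⇒notLast e refl with () ← trans (sym e) lastUnlabelled

  label-fresh : ∀ {v ℓ} → g v ≡ just ℓ → ¬ (k < ℓ)
  label-fresh e = ≤⇒≯ (labelsBelow e)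

Extendable⇒IsEIDSOn-init : ∀ {k g} → Extendable k g → IsEIDSOn k g
Extendable⇒IsEIDSOn-init ext = record
  { supported = λ e → ≤∧≢⇒< (≤-pred (supported e)) (labelled⇒notLast e)
  ; injective = injective
  ; dominator = λ u<k → dominator (m<n⇒m<1+n u<k)
  ; zeroLabel = zeroLabel
  }
  where open Extendable ext

extend : ℕ → (ℕ → Maybe ℕ) → ℕ → Maybe ℕ
extend k g zero    = just (2 + k)
extend k g (suc v) with v ≟ k
... | yes _ = just (suc k)
... | no  _ = g v

extend-old : ∀ {k} g {v} → v ≢ k → extend k g (suc v) ≡ g v
extend-old {k} g {v} v≢k with v ≟ k
... | yes v≡k = contradiction v≡k v≢k
... | no  _   = refl

extend-last : ∀ k g → extend k g (suc k) ≡ just (suc k)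
extend-last k g with k ≟ k
... | yes _   = refl
... | no  k≢k = contradiction refl k≢k

extend-extendable : ∀ {k g} → Extendable k g → Extendable (2 + k) (extend k g)
extend-extendable {k} {g} ext = record
  { eids = record
    { supported = supported′
    ; injective = injective′
    ; dominator = dominator′
    ; zeroLabel = let v , e = zeroLabel in suc v , trans (extend-old g (labelled⇒notLast e)) e
    }
  ; lastUnlabelled = trans (extend-old g 1+n≢n) (unlabelled ≤-refl)
  ; labelsBelow = λ {v} → labelsBelow′ {v}
  }
  where
  open Extendable ext

  supported′ : ∀ {v ℓ} → extend k g v ≡ just ℓ → v < 3 + k
  supported′ {zero} _ = s≤s z≤n
  supported′ {suc v} e with v ≟ k
  ... | yes refl = n≤1+n (2 + k)
  ... | no  _    = s≤s (m<n⇒m<1+n (supported e))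

  labelsBelow′ : ∀ {v ℓ} → extend k g v ≡ just ℓ → ℓ ≤ 2 + k
  labelsBelow′ {zero} refl = ≤-refl
  labelsBelow′ {suc v} e with v ≟ k
  labelsBelow′ {suc v} refl | yes _ = n≤1+n (suc k)
  labelsBelow′ {suc v} e    | no  _ = ≤-trans (labelsBelow e) (m≤n+m k 2)

  injective′ : ∀ {v w ℓ} → extend k g v ≡ just ℓ → extend k g w ≡ just ℓ → v ≡ w
  injective′ {zero} {zero} _ _ = refl
  injective′ {zero} {suc w} refl q with w ≟ k
  ... | yes _ = contradiction (sym (just-injective q)) 1+n≢n
  ... | no  _ = contradiction (m<n+m k (s≤s z≤n)) (label-fresh q)
  injective′ {suc v} {zero} p refl with v ≟ k
  ... | yes _ = contradiction (sym (just-injective p)) 1+n≢n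
  ... | no  _ = contradiction (m<n+m k (s≤s z≤n)) (label-fresh p)
  injective′ {suc v} {suc w} p q with v ≟ k | w ≟ k
  ... | yes v≡k | yes w≡k = cong suc (trans v≡k (sym w≡k))
  injective′ {suc v} {suc w} refl q | yes _ | no _ = contradiction (n<1+n k) (label-fresh q)
  injective′ {suc v} {suc w} p refl | no _ | yes _ = contradiction (n<1+n k) (label-fresh p)
  ... | no  _   | no  _   = cong suc (injective p q)

  dominator′ : ∀ {u} → u < 3 + k → Σ ℕ λ v → extend k g v ≡ just ∣ u - v ∣
  dominator′ {zero}  _ = suc k , extend-last k g
  dominator′ {suc u} (s≤s u<2+k) with m≤n⇒m<n∨m≡n (≤-pred u<2+k)
  ... | inj₂ refl = zero , refl
  ... | inj₁ u<1+k with dominator u<1+k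
  ...   | v , e = suc v , trans (extend-old g (labelled⇒notLast e)) e

P₁-labelling : ℕ → Maybe ℕ
P₁-labelling zero    = just 0
P₁-labelling (suc _) = nothing

P₁-eids : IsEIDSOn 1 P₁-labelling
P₁-eids = record
  { supported = supported
  ; injective = injective
  ; dominator = dominator
  ; zeroLabel = 0 , refl
  }
  where
  supported : ∀ {v ℓ} → P₁-labelling v ≡ just ℓ → v < 1
  supported {zero} _ = s≤s z≤n

  injective : ∀ {v w ℓ} → P₁-labelling v ≡ just ℓ → P₁-labelling w ≡ just ℓ → v ≡ w
  injective {zero} {zero} _ _ = refl
  injective {zero} {suc _} _ ()

  dominator : ∀ {u} → u < 1 → Σ ℕ λ v → P₁-labelling v ≡ just ∣ u - v ∣
  dominator {zero} _ = 0 , refl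
  dominator {suc _} (s≤s ())

P₅-labelling : ℕ → Maybe ℕ
P₅-labelling 0 = just 3
P₅-labelling 1 = just 0
P₅-labelling 2 = just 2
P₅-labelling 3 = just 1
P₅-labelling _ = nothing

P₅-extendable : Extendable 4 P₅-labelling
P₅-extendable = record
  { eids = record
    { supported = supported
    ; injective = λ p q → trans (vertexOf-correct p) (sym (vertexOf-correct q))
    ; dominator = dominator
    ; zeroLabel = 1 , refl
    }
  ; lastUnlabelled = refl
  ; labelsBelow = labelsBelow
  }
  where
  vertexOf : ℕ → ℕ
  vertexOf 3 = 0
  vertexOf 0 = 1
  vertexOf 2 = 2
  vertexOf _ = 3

  vertexOf-correct : ∀ {v ℓ} → P₅-labelling v ≡ just ℓ → v ≡ vertexOf ℓ
  vertexOf-correct {0} refl = refl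
  vertexOf-correct {1} refl = refl
  vertexOf-correct {2} refl = refl
  vertexOf-correct {3} refl = refl

  supported : ∀ {v ℓ} → P₅-labelling v ≡ just ℓ → v < 5
  supported {0} refl = ≤ᵇ⇒≤ _ _ _
  supported {1} refl = ≤ᵇ⇒≤ _ _ _
  supported {2} refl = ≤ᵇ⇒≤ _ _ _
  supported {3} refl = ≤ᵇ⇒≤ _ _ _

  labelsBelow : ∀ {v ℓ} → P₅-labelling v ≡ just ℓ → ℓ ≤ 4
  labelsBelow {0} refl = ≤ᵇ⇒≤ _ _ _
  labelsBelow {1} refl = ≤ᵇ⇒≤ _ _ _
  labelsBelow {2} refl = ≤ᵇ⇒≤ _ _ _
  labelsBelow {3} refl = ≤ᵇ⇒≤ _ _ _

  dominator : ∀ {u} → u < 5 → Σ ℕ λ v → P₅-labelling v ≡ just ∣ u - v ∣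
  dominator {0} _ = 2 , refl
  dominator {1} _ = 1 , refl
  dominator {2} _ = 3 , refl
  dominator {3} _ = 0 , refl
  dominator {4} _ = 3 , refl
  dominator {suc (suc (suc (suc (suc _))))} (s≤s (s≤s (s≤s (s≤s (s≤s ())))))

extendable-P₄₊ₙ⊎P₅₊ₙ : ∀ n → Σ _ (Extendable (3 + n)) ⊎ Σ _ (Extendable (4 + n))
extendable-P₄₊ₙ⊎P₅₊ₙ 0             = inj₂ (_ , P₅-extendable)
extendable-P₄₊ₙ⊎P₅₊ₙ 1             = inj₁ (_ , P₅-extendable)
extendable-P₄₊ₙ⊎P₅₊ₙ (suc (suc n)) = ⊎-map grow grow (extendable-P₄₊ₙ⊎P₅₊ₙ n)
  where
  grow : ∀ {k} → Σ _ (Extendable k) → Σ _ (Extendable (2 + k))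
  grow (g , ext) = extend _ g , extend-extendable ext

P₄₊ₙ-admitsEIDS : ∀ n → PathAdmitsEIDS (4 + n)
P₄₊ₙ-admitsEIDS n with extendable-P₄₊ₙ⊎P₅₊ₙ n
... | inj₁ (_ , ext) = IsEIDSOn⇒PathAdmitsEIDS (Extendable.eids ext)
... | inj₂ (_ , ext) = IsEIDSOn⇒PathAdmitsEIDS (Extendable⇒IsEIDSOn-init ext)

proposition5p5 : (n : ℕ) → 1 ≤ n →
    (PathAdmitsEIDS n ⇔ (¬ (n ≡ 2) × ¬ (n ≡ 3)))
proposition5p5 n 1≤n = mk⇔ necessary (sufficient n 1≤n)
  where
  necessary : PathAdmitsEIDS n → ¬ (n ≡ 2) × ¬ (n ≡ 3)
  necessary eids = (λ { refl → P₂-lacksEIDS eids }) , (λ { refl → P₃-lacksEIDS eids })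

  sufficient : ∀ m → 1 ≤ m → ¬ (m ≡ 2) × ¬ (m ≡ 3) → PathAdmitsEIDS m
  sufficient 1 _ _                   = IsEIDSOn⇒PathAdmitsEIDS P₁-eids
  sufficient 2 _ (m≢2 , _)           = contradiction refl m≢2
  sufficient 3 _ (_ , m≢3)           = contradiction refl m≢3
  sufficient (suc (suc (suc (suc m)))) _ _ = P₄₊ₙ-admitsEIDS m
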